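{- Let $w$ be a nonempty string of length $n$ and let $k \geq 3$ be an integer. Let $r = w^k[i : i+l-1]$ be a run in $w^k$ with begin position $i$, length $l$ and minimum period $p$. If $l \geq 2n$, then $i = 1$ and $l = kn$, i.e. $r = w^k$.
   Context: A string is a finite sequence of symbols from a finite alphabet; $x[i]$ denotes its $i$-th symbol and $x[i:j]$ the substring from position $i$ to position $j$; $w^k$ is the concatenation of $k$ copies of $w$. A string $u$ has period $p$ if $u[i]=u[i+p]$ for $1\le i\le |u|-p$. A string $u$ is a run if its minimum period $p$ satisfies $p \leq |u|/2$. A substring $u = x[i:j]$ of $x$ is a run in $x$ if it is a run of (minimum) period $p$ and neither $x[i-1:j]$ nor $x[i:j+1]$ (whenever these exist) is a run of period $p$, i.e. the run is maximal. -}

module Defs where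

open import Data.Nat using (ℕ; zero; suc; _+_; _*_; _≤_; _<_; pred)
open import Data.List using (List; []; _∷_; length; concat; replicate)
open import Data.Maybe using (Maybe; just; nothing)
open import Data.Product using (_×_)
open import Relation.Binary.PropositionalEquality using (_≡_)
open import Relation.Nullary using (¬_)

-- Positions are 0-indexed: x[j] is  at x j  (nothing if out of range).
at : {A : Set} → List A → ℕ → Maybe A
at []       _       = nothing
at (a ∷ _)  zero    = just a
at (_ ∷ xs) (suc j) = at xs j

_^^_ : {A : Set} → List A → ℕ → List A
w ^^ k = concat (replicate k w)

InRange : {A : Set} → List A → ℕ → ℕ → Set
InRange x i l = i + l ≤ length x

HasPeriod : {A : Set} → List A → ℕ → ℕ → ℕ → Set
HasPeriod x i l p = 1 ≤ p × (∀ j → j + p < l → at x (i + j) ≡ at x (i + j + p))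

MinPeriod : {A : Set} → List A → ℕ → ℕ → ℕ → Set
MinPeriod x i l p = p ≤ l × HasPeriod x i l p × (∀ q → q < p → ¬ HasPeriod x i l q)

IsRun : {A : Set} → List A → ℕ → ℕ → ℕ → Set
IsRun x i l p = InRange x i l × MinPeriod x i l p × 2 * p ≤ l

RunIn : {A : Set} → List A → ℕ → ℕ → ℕ → Set
RunIn x i l p =
  IsRun x i l p ×
  (1 ≤ i → ¬ IsRun x (pred i) (suc l) p) ×
  (i + l < length x → ¬ IsRun x i (suc l) p)

-- w^k has period n = |w| throughout. If a window of length l has period p and
-- n + p ≤ l (which follows from 2n ≤ l and 2p ≤ l), the symbol just outside it
-- agrees with the one p further in: step n across the string, p inside the
-- window, and n back. So the window extends on either side with the same
-- minimal period, and a maximal run can only be all of w^k.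
module Submission where

open import Defs
open import Data.Nat using (ℕ; zero; suc; _+_; _*_; _≤_; _<_; z≤n; s≤s; z<s; _<?_)
open import Data.Nat.Properties
open import Data.Nat.Tactic.RingSolver using (solve-∀)
open import Data.Fin using (Fin)
open import Data.List using (List; []; _∷_; _++_; length)
open import Data.List.Properties using (length-++; ++-assoc; ++-identityʳ)
open import Data.Product using (_×_; _,_)
open import Data.Sum using (inj₁; inj₂)
open import Data.Empty using (⊥-elim)
open import Relation.Nullary using (yes; no)
open import Function using (_∘_)
open import Relation.Binary.PropositionalEquality using (_≡_; refl; sym; trans; cong; subst; module ≡-Reasoning)
open ≡-Reasoning

module _ {A : Set} where

  at-++ˡ : (xs ys : List A) {j : ℕ} → j < length xs → at (xs ++ ys) j ≡ at xs j
  at-++ˡ (_ ∷ _)  ys {zero}  _         = refl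
  at-++ˡ (_ ∷ xs) ys {suc j} (s≤s j<) = at-++ˡ xs ys j<

  at-++ʳ : (xs ys : List A) (j : ℕ) → at (xs ++ ys) (length xs + j) ≡ at ys j
  at-++ʳ []       ys j = refl
  at-++ʳ (_ ∷ xs) ys j = at-++ʳ xs ys j

  length-^^ : (w : List A) (k : ℕ) → length (w ^^ k) ≡ k * length w
  length-^^ w zero    = refl
  length-^^ w (suc k) = trans (length-++ w) (cong (length w +_) (length-^^ w k))

  ^^-sucʳ : (w : List A) (k : ℕ) → w ^^ suc k ≡ w ^^ k ++ w
  ^^-sucʳ w zero    = ++-identityʳ w
  ^^-sucʳ w (suc k) = trans (cong (w ++_) (^^-sucʳ w k)) (sym (++-assoc w (w ^^ k) w))

  ^^-hasPeriod : (w : List A) (k : ℕ) → 1 ≤ length w →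
                 HasPeriod (w ^^ k) 0 (length (w ^^ k)) (length w)
  ^^-hasPeriod w k 1≤n = 1≤n , periodic k
    where
    n = length w
    periodic : ∀ k j → j + n < length (w ^^ k) → at (w ^^ k) j ≡ at (w ^^ k) (j + n)
    periodic zero    j ()
    periodic (suc k) j j+n<len = begin
      at (w ^^ suc k) j         ≡⟨ cong (λ v → at v j) (^^-sucʳ w k) ⟩
      at (w ^^ k ++ w) j        ≡⟨ at-++ˡ (w ^^ k) w j<len ⟩
      at (w ^^ k) j             ≡⟨ sym (at-++ʳ w (w ^^ k) j) ⟩
      at (w ^^ suc k) (n + j)   ≡⟨ cong (at (w ^^ suc k)) (+-comm n j) ⟩
      at (w ^^ suc k) (j + n)   ∎
      where
      j<len : j < length (w ^^ k)
      j<len = +-cancelʳ-< n j (length (w ^^ k))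
                (subst (j + n <_) (trans (length-++ w) (+-comm n _)) j+n<len)

module _ {A : Set} (x : List A) where

  hasPeriod-dropFirst : ∀ {i l q} → HasPeriod x i (suc l) q → HasPeriod x (suc i) l q
  hasPeriod-dropFirst {i} {q = q} (1≤q , period) = 1≤q , λ j j+q<l →
    subst (λ a → at x a ≡ at x (a + q)) (+-suc i j) (period (suc j) (s≤s j+q<l))

  hasPeriod-dropLast : ∀ {i l q} → HasPeriod x i (suc l) q → HasPeriod x i l q
  hasPeriod-dropLast (1≤q , period) = 1≤q , λ j j+q<l → period j (m≤n⇒m≤1+n j+q<l)

  isRun-extend : ∀ {i l i′ l′ p} → l ≤ l′ → InRange x i′ l′ →
                 (∀ {q} → HasPeriod x i′ l′ q → HasPeriod x i l q) →
                 HasPeriod x i′ l′ p → IsRun x i l p → IsRun x i′ l′ p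
  isRun-extend l≤l′ inRange restrict hasPeriod (_ , (p≤l , _ , minimal) , 2p≤l) =
    inRange ,
    (≤-trans p≤l l≤l′ , hasPeriod , λ q q<p → minimal q q<p ∘ restrict) ,
    ≤-trans 2p≤l l≤l′

  hasPeriod-extendˡ : ∀ {n i l p} → HasPeriod x 0 (length x) n → n + p ≤ l →
                      InRange x (suc i) l → HasPeriod x (suc i) l p → HasPeriod x i (suc l) p
  hasPeriod-extendˡ {suc n′} {i} {l} {p} (_ , periodic) n+p≤l inRange (1≤p , local) =
    1≤p , extended
    where
    n = suc n′
    inside : ∀ {a} → a ≤ i + l → a < length x
    inside a≤i+l = ≤-trans (s≤s a≤i+l) inRange
    extended : ∀ j → j + p < suc l → at x (i + j) ≡ at x (i + j + p)
    extended zero _ = begin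
      at x (i + 0)            ≡⟨ cong (at x) (+-identityʳ i) ⟩
      at x i                  ≡⟨ periodic i (inside (+-monoʳ-≤ i (m+n≤o⇒m≤o n n+p≤l))) ⟩
      at x (i + n)            ≡⟨ cong (at x) (+-suc i n′) ⟩
      at x (suc i + n′)       ≡⟨ local n′ n+p≤l ⟩
      at x (suc i + n′ + p)   ≡⟨ cong (at x) (shift i n′ p) ⟩
      at x (i + p + n)        ≡⟨ sym (periodic (i + p) (inside i+p+n≤i+l)) ⟩
      at x (i + p)            ≡⟨ cong (λ a → at x (a + p)) (sym (+-identityʳ i)) ⟩
      at x (i + 0 + p)        ∎
      where
      shift : ∀ a b c → suc a + b + c ≡ a + c + suc b
      shift = solve-∀
      i+p+n≤i+l : i + p + n ≤ i + l
      i+p+n≤i+l = ≤-trans (≤-reflexive (+-assoc i p n))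
                    (+-monoʳ-≤ i (subst (_≤ l) (+-comm n p) n+p≤l))
    extended (suc j) (s≤s j+p<l) =
      subst (λ a → at x a ≡ at x (a + p)) (sym (+-suc i j)) (local j j+p<l)

  hasPeriod-extendʳ : ∀ {n i l p} → HasPeriod x 0 (length x) n → n + p ≤ l →
                      i + l < length x → HasPeriod x i l p → HasPeriod x i (suc l) p
  hasPeriod-extendʳ {suc n′} {i} {l} {p} (_ , periodic) n+p≤l i+l<len (1≤p , local) =
    1≤p , extended
    where
    n = suc n′
    extended : ∀ j → j + p < suc l → at x (i + j) ≡ at x (i + j + p)
    extended j (s≤s j+p≤l) with m≤n⇒m<n∨m≡n j+p≤l
    ... | inj₁ j+p<l = local j j+p<l
    ... | inj₂ j+p≡l with m≤n⇒∃[o]m+o≡n (+-cancelʳ-≤ p n j (subst (n + p ≤_) (sym j+p≡l) n+p≤l))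
    ...   | m , refl = begin
      at x (i + (n + m))      ≡⟨ cong (at x) (shiftˡ i n m) ⟩
      at x (i + m + n)        ≡⟨ sym (periodic (i + m) i+m+n<len) ⟩
      at x (i + m)            ≡⟨ local m (subst (m + p <_) j+p≡l (+-monoˡ-< p (m<n+m m z<s))) ⟩
      at x (i + m + p)        ≡⟨ periodic (i + m + p) i+m+p+n<len ⟩
      at x (i + m + p + n)    ≡⟨ cong (at x) (shiftʳ i n m p) ⟩
      at x (i + (n + m) + p)  ∎
      where
      shiftˡ : ∀ a b c → a + (b + c) ≡ a + c + b
      shiftˡ = solve-∀
      shiftʳ : ∀ a b c d → a + c + d + b ≡ a + (b + c) + d
      shiftʳ = solve-∀
      regroup : ∀ a b c d → a + c + d + b ≡ a + (b + c + d)
      regroup = solve-∀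
      i+m+p+n<len : i + m + p + n < length x
      i+m+p+n<len = subst (_< length x) (trans (cong (i +_) (sym j+p≡l)) (sym (regroup i n m p)))
                      i+l<len
      i+m+n<len : i + m + n < length x
      i+m+n<len = ≤-<-trans (+-monoˡ-≤ n (m≤m+n (i + m) p)) i+m+p+n<len

  runIn-spans : ∀ {n i l p} → HasPeriod x 0 (length x) n → n + p ≤ l →
                RunIn x i l p → (i ≡ 0) × (l ≡ length x)
  runIn-spans {i = suc i} {l} periodic n+p≤l (run@(inRange , (_ , local , _) , _) , notLeft , _) =
    ⊥-elim (notLeft (s≤s z≤n) (isRun-extend (n≤1+n l) inRange′ hasPeriod-dropFirst
      (hasPeriod-extendˡ periodic n+p≤l inRange local) run))
    where
    inRange′ : InRange x i (suc l)
    inRange′ = subst (_≤ length x) (sym (+-suc i l)) inRange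
  runIn-spans {i = zero} {l} periodic n+p≤l (run@(inRange , (_ , local , _) , _) , _ , notRight)
    with l <? length x
  ... | yes l<len = ⊥-elim (notRight l<len (isRun-extend (n≤1+n l) l<len hasPeriod-dropLast
                      (hasPeriod-extendʳ periodic n+p≤l l<len local) run))
  ... | no l≮len = refl , ≤∧≮⇒≡ inRange l≮len

+-≤-from-doubles : ∀ m n {l} → 2 * m ≤ l → 2 * n ≤ l → m + n ≤ l
+-≤-from-doubles m n {l} 2m≤l 2n≤l with ≤-total m n
... | inj₁ m≤n = ≤-trans (+-monoˡ-≤ n m≤n) (subst (_≤ l) (cong (n +_) (+-identityʳ n)) 2n≤l)
... | inj₂ n≤m = ≤-trans (+-monoʳ-≤ m n≤m) (subst (_≤ l) (cong (m +_) (+-identityʳ m)) 2m≤l)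

lemma2 : (σ : ℕ) (w : List (Fin σ)) (n k i l p : ℕ) →
         length w ≡ n → 1 ≤ n → 3 ≤ k →
         RunIn (w ^^ k) i l p →
         2 * n ≤ l →
         (i ≡ 0) × (l ≡ k * n)
lemma2 σ w .(length w) k i l p refl 1≤n _ run@((_ , _ , 2p≤l) , _) 2n≤l
  with runIn-spans (w ^^ k) (^^-hasPeriod w k 1≤n) (+-≤-from-doubles (length w) p 2n≤l 2p≤l) run
... | i≡0 , l≡len = i≡0 , trans l≡len (length-^^ w k)
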